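{- Let $k\geq 2$. If a $3$-edge-colored complete graph contains a balanced $P_{3k-3}$ and a rainbow triangle vertex-disjoint from it, then it contains a balanced $P_{3k}$.
   Context: $P_m$ denotes the path with $m$ edges. A $3$-edge-colored path $P_{3j}$ is balanced if each of the three colors appears on exactly $j$ of its edges. A rainbow triangle is a triangle whose three edges have three distinct colors. -}

module Defs where

open import Data.Nat using (ℕ; suc; _*_)
open import Data.Fin using (Fin; inject₁) renaming (suc to fsuc)
open import Data.Fin.Properties using (_≟_)
open import Data.List using (List; length; filter; allFin; map)
open import Data.Product using (Σ; _×_; _,_)
open import Relation.Binary.PropositionalEquality using (_≡_; _≢_)
open import Function.Definitions using (Injective)

-- A 3-edge-colouring of the complete graph K_n on vertex set Fin n:
-- a colour for every ordered pair, symmetric; values on loops are irrelevant.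
record Colouring (n : ℕ) : Set where
  field
    col : Fin n → Fin n → Fin 3
    sym : ∀ u v → col u v ≡ col v u
open Colouring public

-- A path with m edges (P_m) in K_n: m+1 pairwise distinct vertices.
record Path (n m : ℕ) : Set where
  field
    vtx : Fin (suc m) → Fin n
    inj : Injective _≡_ _≡_ vtx
open Path public

edgeCol : ∀ {n m} → Colouring n → Path n m → Fin m → Fin 3
edgeCol c p i = col c (vtx p (inject₁ i)) (vtx p (fsuc i))

count : ∀ {n m} → Colouring n → Path n m → Fin 3 → ℕ
count {m = m} c p a = length (filter (λ i → edgeCol c p i ≟ a) (allFin m))

Balanced : ∀ {n} (j : ℕ) → Colouring n → Path n (3 * j) → Set
Balanced j c p = ∀ (a : Fin 3) → count c p a ≡ j

Rainbow : ∀ {n} → Colouring n → Fin n → Fin n → Fin n → Set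
Rainbow c x y z =
  (x ≢ y × y ≢ z × x ≢ z) ×
  (col c x y ≢ col c y z × col c y z ≢ col c x z × col c x y ≢ col c x z)

NotOn : ∀ {n m} → Fin n → Path n m → Set
NotOn v p = ∀ i → vtx p i ≢ v

module Submission where

-- Append the three triangle vertices to an end e of the path, in an order making the three new
-- edges rainbow. Such an order exists unless every edge from e to the triangle repeats the colour
-- of the opposite side. If that happens at both ends v (first) and l (last), the first edge v v₁
-- has a triangle colour, say that of y z, which is also the colour of v x; then v₁ … l y z v x is a
-- path that trades v v₁ for v x and gains l y, y z, z v, which carry the three colours.

open import Defs
open import Data.Nat using (ℕ; suc; _+_; _*_; _∸_; _≤_; s≤s)
import Data.Nat as ℕ
open import Data.Nat.Properties using (+-comm; *-suc)
open import Data.Fin using (Fin; inject₁) renaming (zero to fzero; suc to fsuc)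
open import Data.Fin.Properties using (_≟_; all?)
open import Data.List using (List; []; _∷_; _++_; length; filter; map; tabulate; lookup; allFin)
open import Data.List.Properties using (length-++; filter-++; length-tabulate; map-tabulate; tabulate-lookup)
open import Data.List.Relation.Unary.All as All using (All; []; _∷_)
open import Data.List.Relation.Unary.AllPairs using ([]; _∷_)
open import Data.List.Relation.Unary.Unique.Propositional using (Unique)
open import Data.List.Relation.Unary.Unique.Propositional.Properties using (++⁺; tabulate⁺)
open import Data.List.Relation.Binary.Permutation.Propositional
  using (_↭_; ↭-refl; ↭-sym; ↭-trans; ↭-reflexive; ↭-prep; ↭-swap; ↭⇒↭ₛ; module PermutationReasoning)
open import Data.List.Relation.Binary.Permutation.Propositional.Properties
  using (++⁺ˡ; ++-comm; shift; filter-↭; ↭-length; ↭-reverse)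
import Data.List.Relation.Binary.Permutation.Setoid.Properties as Permutationₛ
open import Data.List.Membership.Propositional using (_∈_)
open import Data.List.Membership.Propositional.Properties using (∈-lookup; ∈-tabulate⁻)
open import Data.Product using (Σ; _×_; _,_; map₂)
open import Data.Sum using (_⊎_; inj₁; inj₂)
open import Data.Empty using (⊥; ⊥-elim)
open import Data.Bool using (true; false)
open import Function using (_∘_; id)
open import Function.Definitions using (Injective)
open import Relation.Binary.PropositionalEquality as ≡
  using (_≡_; _≢_; refl; cong; ≢-sym; module ≡-Reasoning)
open import Relation.Binary.PropositionalEquality.Properties using (setoid)
open import Relation.Nullary using (yes; no; does)
open import Relation.Nullary.Decidable using (Dec; from-yes; ¬?; _×-dec_; _⊎-dec_; _→-dec_)
open import Relation.Unary using (Pred; Decidable)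

Distinct3 : ∀ {a} {A : Set a} → A → A → A → Set a
Distinct3 p q r = p ≢ q × q ≢ r × p ≢ r

module _ {a} {A : Set a} {p q r : A} where

  Distinct3-rotate : Distinct3 p q r → Distinct3 q r p
  Distinct3-rotate (p≢q , q≢r , p≢r) = q≢r , ≢-sym p≢r , ≢-sym p≢q

  Distinct3-reverse : Distinct3 p q r → Distinct3 r q p
  Distinct3-reverse (p≢q , q≢r , p≢r) = ≢-sym q≢r , ≢-sym p≢q , ≢-sym p≢r

  Distinct3-resp : ∀ {p′ q′ r′} → p ≡ p′ → q ≡ q′ → r ≡ r′ → Distinct3 p q r → Distinct3 p′ q′ r′
  Distinct3-resp refl refl refl d = d

multiplicity : Fin 3 → List (Fin 3) → ℕ
multiplicity a cs = length (filter (_≟ a) cs)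

multiplicity-++ : ∀ a xs ys → multiplicity a (xs ++ ys) ≡ multiplicity a xs + multiplicity a ys
multiplicity-++ a xs ys = ≡.trans (cong length (filter-++ (_≟ a) xs ys)) (length-++ (filter (_≟ a) xs))

multiplicity-↭ : ∀ a {xs ys} → xs ↭ ys → multiplicity a xs ≡ multiplicity a ys
multiplicity-↭ a xs↭ys = ↭-length (filter-↭ (_≟ a) xs↭ys)

length-filter-map : ∀ {a b p} {A : Set a} {B : Set b} {P : Pred B p} (P? : Decidable P) (f : A → B) xs →
                    length (filter (P? ∘ f) xs) ≡ length (filter P? (map f xs))
length-filter-map P? f [] = refl
length-filter-map P? f (x ∷ xs) with does (P? (f x))
... | true  = cong suc (length-filter-map P? f xs)
... | false = length-filter-map P? f xs

Distinct3? : (p q r : Fin 3) → Dec (Distinct3 p q r)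
Distinct3? p q r = ¬? (p ≟ q) ×-dec ¬? (q ≟ r) ×-dec ¬? (p ≟ r)

Distinct3-cover : ∀ p q r → Distinct3 p q r → ∀ d → d ≡ p ⊎ d ≡ q ⊎ d ≡ r
Distinct3-cover = from-yes (all? λ p → all? λ q → all? λ r →
  Distinct3? p q r →-dec all? λ d → d ≟ p ⊎-dec d ≟ q ⊎-dec d ≟ r)

Distinct3-multiplicity : ∀ p q r → Distinct3 p q r → ∀ a → multiplicity a (p ∷ q ∷ r ∷ []) ≡ 1
Distinct3-multiplicity = from-yes (all? λ p → all? λ q → all? λ r →
  Distinct3? p q r →-dec all? λ a → multiplicity a (p ∷ q ∷ r ∷ []) ℕ.≟ 1)

Unique-resp-↭ : ∀ {a} {A : Set a} {xs ys : List A} → Unique xs → xs ↭ ys → Unique ys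
Unique-resp-↭ {A = A} u xs↭ys = Permutationₛ.Unique-resp-↭ (setoid A) (↭⇒↭ₛ xs↭ys) u

lookup-injective : ∀ {a} {A : Set a} {xs : List A} → Unique xs → Injective _≡_ _≡_ (lookup xs)
lookup-injective {xs = _ ∷ _} _         {fzero}  {fzero}  _   = refl
lookup-injective              (x∉ ∷ _) {fzero}  {fsuc j} x≡  = ⊥-elim (All.lookup x∉ (∈-lookup j) x≡)
lookup-injective              (x∉ ∷ _) {fsuc i} {fzero}  ≡x  = ⊥-elim (All.lookup x∉ (∈-lookup i) (≡.sym ≡x))
lookup-injective              (_ ∷ u)  {fsuc i} {fsuc j} eq  = cong fsuc (lookup-injective u eq)

module _ {n : ℕ} (c : Colouring n) where

  colours : List (Fin n) → List (Fin 3)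
  colours (u ∷ v ∷ vs) = col c u v ∷ colours (v ∷ vs)
  colours _            = []

  last : Fin n → List (Fin n) → Fin n
  last v []       = v
  last _ (w ∷ ws) = last w ws

  colours-++ : ∀ v vs w ws → colours ((v ∷ vs) ++ w ∷ ws) ≡ colours (v ∷ vs) ++ col c (last v vs) w ∷ colours (w ∷ ws)
  colours-++ v []        w ws = refl
  colours-++ v (v′ ∷ vs) w ws = cong (col c v v′ ∷_) (colours-++ v′ vs w ws)

  record Extension (L N : List (Fin n)) : Set where
    constructor extension
    field
      vertices      : List (Fin n)
      vertices-↭    : vertices ↭ L ++ N
      p q r         : Fin 3
      rainbow       : Distinct3 p q r
      colours-↭     : colours vertices ↭ p ∷ q ∷ r ∷ colours L

  Extension-↭ : ∀ {L N N′} → N ↭ N′ → Extension L N → Extension L N′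
  Extension-↭ {L} N↭N′ (extension vs vs↭ p q r rb cs↭) = extension vs (↭-trans vs↭ (++⁺ˡ L N↭N′)) p q r rb cs↭

  Extension-multiplicity : ∀ {L N} (E : Extension L N) a →
    multiplicity a (colours (Extension.vertices E)) ≡ suc (multiplicity a (colours L))
  Extension-multiplicity {L} (extension vs _ p q r rb cs↭) a = begin
    multiplicity a (colours vs)                                ≡⟨ multiplicity-↭ a cs↭ ⟩
    multiplicity a ((p ∷ q ∷ r ∷ []) ++ colours L)              ≡⟨ multiplicity-++ a (p ∷ q ∷ r ∷ []) (colours L) ⟩
    multiplicity a (p ∷ q ∷ r ∷ []) + multiplicity a (colours L) ≡⟨ cong (_+ multiplicity a (colours L)) (Distinct3-multiplicity p q r rb a) ⟩
    suc (multiplicity a (colours L))                           ∎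
    where open ≡-Reasoning

  record RainbowTail (e : Fin n) (N : List (Fin n)) : Set where
    constructor tail
    field
      u w t     : Fin n
      reorder   : u ∷ w ∷ t ∷ [] ↭ N
      rainbow   : Distinct3 (col c e u) (col c u w) (col c w t)

  RainbowTail-↭ : ∀ {e N N′} → N ↭ N′ → RainbowTail e N → RainbowTail e N′
  RainbowTail-↭ N↭N′ (tail u w t uwt↭ rb) = tail u w t (↭-trans uwt↭ N↭N′) rb

  extend-at-end : ∀ v vs {N} → RainbowTail (last v vs) N → Extension (v ∷ vs) N
  extend-at-end v vs (tail u w t uwt↭ rb) =
    extension ((v ∷ vs) ++ u ∷ w ∷ t ∷ []) (++⁺ˡ (v ∷ vs) uwt↭) _ _ _ rb
      (↭-trans (↭-reflexive (colours-++ v vs u (w ∷ t ∷ []))) (++-comm (colours (v ∷ vs)) _))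

  extend-at-start : ∀ v vs {N} → RainbowTail v N → Extension (v ∷ vs) N
  extend-at-start v vs (tail u w t uwt↭ rb) =
    extension (t ∷ w ∷ u ∷ v ∷ vs) twu↭ _ _ _ rb′ ↭-refl
    where
      twu↭ : t ∷ w ∷ u ∷ v ∷ vs ↭ (v ∷ vs) ++ _
      twu↭ = ↭-trans (++-comm (t ∷ w ∷ u ∷ []) (v ∷ vs)) (++⁺ˡ (v ∷ vs) (↭-trans (↭-reverse (u ∷ w ∷ t ∷ [])) uwt↭))
      rb′ : Distinct3 (col c t w) (col c w u) (col c u v)
      rb′ = Distinct3-resp (sym c w t) (sym c u w) (sym c v u) (Distinct3-reverse rb)

  -- Drop the first edge v v₁ and reattach v in the middle of a tail, with a new edge v t of the same colour.
  extend-by-detour : ∀ v v₁ vs u w t {N} → u ∷ w ∷ t ∷ [] ↭ N →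
    Distinct3 (col c (last v₁ vs) u) (col c u w) (col c w v) → col c v t ≡ col c v v₁ →
    Extension (v ∷ v₁ ∷ vs) N
  extend-by-detour v v₁ vs u w t {N} uwt↭ rb vt≡vv₁ = extension ((v₁ ∷ vs) ++ u ∷ w ∷ v ∷ t ∷ []) vs↭ _ _ _ rb cs↭
    where
      open PermutationReasoning
      vs↭ : (v₁ ∷ vs) ++ u ∷ w ∷ v ∷ t ∷ [] ↭ (v ∷ v₁ ∷ vs) ++ N
      vs↭ = begin
        (v₁ ∷ vs) ++ u ∷ w ∷ v ∷ t ∷ [] ↭⟨ ++⁺ˡ (v₁ ∷ vs) (shift v (u ∷ w ∷ []) (t ∷ [])) ⟩
        (v₁ ∷ vs) ++ v ∷ u ∷ w ∷ t ∷ [] ↭⟨ shift v (v₁ ∷ vs) _ ⟩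
        v ∷ (v₁ ∷ vs) ++ u ∷ w ∷ t ∷ [] ↭⟨ ↭-prep v (++⁺ˡ (v₁ ∷ vs) uwt↭) ⟩
        v ∷ (v₁ ∷ vs) ++ N              ∎
      triple : List (Fin 3)
      triple = col c (last v₁ vs) u ∷ col c u w ∷ col c w v ∷ []
      cs↭ : colours ((v₁ ∷ vs) ++ u ∷ w ∷ v ∷ t ∷ []) ↭ triple ++ colours (v ∷ v₁ ∷ vs)
      cs↭ = begin
        colours ((v₁ ∷ vs) ++ u ∷ w ∷ v ∷ t ∷ [])      ≡⟨ colours-++ v₁ vs u (w ∷ v ∷ t ∷ []) ⟩
        colours (v₁ ∷ vs) ++ triple ++ col c v t ∷ []  ↭⟨ ++-comm (colours (v₁ ∷ vs)) _ ⟩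
        triple ++ col c v t ∷ colours (v₁ ∷ vs)        ≡⟨ cong (λ s → triple ++ s ∷ colours (v₁ ∷ vs)) vt≡vv₁ ⟩
        triple ++ colours (v ∷ v₁ ∷ vs)                ∎

  RainbowCycle : Fin n → Fin n → Fin n → Set
  RainbowCycle x y z = Distinct3 (col c x y) (col c y z) (col c z x)

  Mirrors : Fin n → Fin n → Fin n → Fin n → Set
  Mirrors e x y z = col c e x ≡ col c y z × col c e y ≡ col c z x × col c e z ≡ col c x y

  Mirrors-rotate : ∀ {e x y z} → Mirrors e x y z → Mirrors e y z x
  Mirrors-rotate (ex , ey , ez) = ey , ez , ex

  -- col c e x is the colour of one of the two triangle sides at x; leave x along the other one.
  tail-at : ∀ {e x y z} → RainbowCycle x y z → col c e x ≢ col c y z → RainbowTail e (x ∷ y ∷ z ∷ [])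
  tail-at {e} {x} {y} {z} T ex≢yz with Distinct3-cover _ _ _ T (col c e x)
  ... | inj₁ ex≡xy        = tail x z y (↭-prep x (↭-swap z y ↭-refl))
                              (Distinct3-resp (≡.sym ex≡xy) (sym c z x) (sym c y z) (Distinct3-reverse (Distinct3-rotate T)))
  ... | inj₂ (inj₁ ex≡yz) = ⊥-elim (ex≢yz ex≡yz)
  ... | inj₂ (inj₂ ex≡zx) = tail x y z ↭-refl
                              (Distinct3-resp (≡.sym ex≡zx) refl refl (Distinct3-rotate (Distinct3-rotate T)))

  tail-or-mirror : ∀ {x y z} → RainbowCycle x y z → ∀ e → RainbowTail e (x ∷ y ∷ z ∷ []) ⊎ Mirrors e x y z
  tail-or-mirror {x} {y} {z} T e with col c e x ≟ col c y z | col c e y ≟ col c z x | col c e z ≟ col c x y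
  ... | no ex≢yz | _        | _        = inj₁ (tail-at T ex≢yz)
  ... | yes _    | no ey≢zx | _        = inj₁ (RainbowTail-↭ (shift x (y ∷ z ∷ []) [])
                                                (tail-at (Distinct3-rotate T) ey≢zx))
  ... | yes _    | yes _    | no ez≢xy = inj₁ (RainbowTail-↭ (↭-sym (shift z (x ∷ y ∷ []) []))
                                                (tail-at (Distinct3-rotate (Distinct3-rotate T)) ez≢xy))
  ... | yes ex   | yes ey   | yes ez   = inj₂ (ex , ey , ez)

  detour-at : ∀ {x y z} v v₁ vs → RainbowCycle x y z → Mirrors (last v₁ vs) x y z → Mirrors v x y z →
    col c v x ≡ col c v v₁ → Extension (v ∷ v₁ ∷ vs) (y ∷ z ∷ x ∷ [])
  detour-at {x} {y} {z} v v₁ vs T (_ , ly , _) (_ , _ , vz) vx≡vv₁ =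
    extend-by-detour v v₁ vs y z x ↭-refl
      (Distinct3-resp (≡.sym ly) refl (≡.trans (≡.sym vz) (sym c v z)) (Distinct3-reverse T)) vx≡vv₁

  -- col c v v₁ is a triangle colour, hence equals col c v t for the triangle vertex t opposite to it.
  detour : ∀ {x y z} v v₁ vs → RainbowCycle x y z → Mirrors (last v₁ vs) x y z → Mirrors v x y z →
    Extension (v ∷ v₁ ∷ vs) (x ∷ y ∷ z ∷ [])
  detour {x} {y} {z} v v₁ vs T ml mv@(vx , vy , vz) with Distinct3-cover _ _ _ T (col c v v₁)
  ... | inj₂ (inj₁ vv₁≡yz) = Extension-↭ (shift x (y ∷ z ∷ []) [])
                               (detour-at v v₁ vs T ml mv (≡.trans vx (≡.sym vv₁≡yz)))
  ... | inj₂ (inj₂ vv₁≡zx) = Extension-↭ (↭-sym (shift z (x ∷ y ∷ []) []))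
                               (detour-at v v₁ vs (Distinct3-rotate T) (Mirrors-rotate ml) (Mirrors-rotate mv)
                                 (≡.trans vy (≡.sym vv₁≡zx)))
  ... | inj₁ vv₁≡xy        = detour-at v v₁ vs (Distinct3-rotate (Distinct3-rotate T))
                               (Mirrors-rotate (Mirrors-rotate ml)) (Mirrors-rotate (Mirrors-rotate mv))
                               (≡.trans vz (≡.sym vv₁≡xy))

  -- The edge v v₁ is needed: a lone vertex mirroring the triangle admits no rainbow tail.
  extend-vertices : ∀ {x y z} → RainbowCycle x y z → ∀ v v₁ vs → Extension (v ∷ v₁ ∷ vs) (x ∷ y ∷ z ∷ [])
  extend-vertices T v v₁ vs with tail-or-mirror T (last v₁ vs) | tail-or-mirror T v
  ... | inj₁ endTail | _              = extend-at-end v (v₁ ∷ vs) endTail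
  ... | inj₂ _       | inj₁ startTail = extend-at-start v (v₁ ∷ vs) startTail
  ... | inj₂ ml      | inj₂ mv        = detour v v₁ vs T ml mv

  vertexList : ∀ {m} → Path n m → List (Fin n)
  vertexList p = tabulate (vtx p)

  colours-tabulate : ∀ {m} (f : Fin (suc m) → Fin n) →
    colours (tabulate f) ≡ tabulate (λ i → col c (f (inject₁ i)) (f (fsuc i)))
  colours-tabulate {ℕ.zero} f = refl
  colours-tabulate {suc m}  f = cong (col c (f fzero) (f (fsuc fzero)) ∷_) (colours-tabulate (f ∘ fsuc))

  count≡multiplicity : ∀ {m} (p : Path n m) a → count c p a ≡ multiplicity a (colours (vertexList p))
  count≡multiplicity {m} p a = begin
    count c p a                                      ≡⟨ length-filter-map (_≟ a) (edgeCol c p) (allFin m) ⟩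
    multiplicity a (map (edgeCol c p) (allFin m))    ≡⟨ cong (multiplicity a) (map-tabulate id (edgeCol c p)) ⟩
    multiplicity a (tabulate (edgeCol c p))          ≡⟨ cong (multiplicity a) (≡.sym (colours-tabulate (vtx p))) ⟩
    multiplicity a (colours (vertexList p))          ∎
    where open ≡-Reasoning

  fromList : ∀ {m} (vs : List (Fin n)) → Unique vs → length vs ≡ suc m →
    Σ (Path n m) λ q → ∀ a → count c q a ≡ multiplicity a (colours vs)
  fromList vs@(_ ∷ _) u refl = q , λ a →
    ≡.trans (count≡multiplicity q a) (cong (multiplicity a ∘ colours) (tabulate-lookup vs))
    where
      q : Path n _
      q = record { vtx = lookup vs ; inj = lookup-injective u }

  unique-++-fresh : ∀ {m} (p : Path n m) {N} → Unique N → All (λ v → NotOn v p) N → Unique (vertexList p ++ N)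
  unique-++-fresh p uN fresh = ++⁺ (tabulate⁺ (inj p)) uN disjoint
    where
      disjoint : ∀ {v} → v ∈ vertexList p × v ∈ _ → ⊥
      disjoint (v∈p , v∈N) with ∈-tabulate⁻ {f = vtx p} v∈p
      ... | i , refl = All.lookup fresh v∈N i refl

  extend-path : ∀ {m J x y z} (p : Path n (suc m)) → (∀ a → count c p a ≡ J) → Rainbow c x y z →
    NotOn x p → NotOn y p → NotOn z p → Σ (Path n (suc m + 3)) λ q → ∀ a → count c q a ≡ suc J
  extend-path {m} {J} {x} {y} {z} p bal ((x≢y , y≢z , x≢z) , colours-distinct) x∉p y∉p z∉p =
    map₂ (λ {q} → counts {q}) (fromList vertices unique length≡)
    where
      open ≡-Reasoning
      E : Extension (vertexList p) (x ∷ y ∷ z ∷ [])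
      E = extend-vertices (Distinct3-resp refl refl (sym c x z) colours-distinct) _ _ _
      open Extension E using (vertices; vertices-↭)
      unique : Unique vertices
      unique = Unique-resp-↭
        (unique-++-fresh p ((x≢y ∷ x≢z ∷ []) ∷ (y≢z ∷ []) ∷ [] ∷ []) (x∉p ∷ y∉p ∷ z∉p ∷ []))
        (↭-sym vertices-↭)
      length≡ : length vertices ≡ suc (suc m + 3)
      length≡ = begin
        length vertices                          ≡⟨ ↭-length vertices-↭ ⟩
        length (vertexList p ++ x ∷ y ∷ z ∷ [])  ≡⟨ length-++ (vertexList p) ⟩
        length (vertexList p) + 3                ≡⟨ cong (_+ 3) (length-tabulate (vtx p)) ⟩
        suc (suc m + 3)                          ∎
      counts : ∀ {q : Path n (suc m + 3)} →
        (∀ a → count c q a ≡ multiplicity a (colours vertices)) → ∀ a → count c q a ≡ suc J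
      counts {q} q≡E a = begin
        count c q a                                    ≡⟨ q≡E a ⟩
        multiplicity a (colours vertices)              ≡⟨ Extension-multiplicity E a ⟩
        suc (multiplicity a (colours (vertexList p)))  ≡⟨ cong suc (≡.trans (≡.sym (count≡multiplicity p a)) (bal a)) ⟩
        suc J                                          ∎

lemma3p3 : (k : ℕ) → 2 ≤ k → (n : ℕ) → (c : Colouring n) →
    (p : Path n (3 * (k ∸ 1))) → Balanced (k ∸ 1) c p →
    (x y z : Fin n) → Rainbow c x y z →
    NotOn x p → NotOn y p → NotOn z p →
    Σ (Path n (3 * k)) (λ q → Balanced k c q)
lemma3p3 (suc ℕ.zero) (s≤s ())
lemma3p3 (suc (suc j)) _ n c p bal x y z rainbow x∉p y∉p z∉p =
  ≡.subst (λ m → Σ (Path n m) λ q → ∀ a → count c q a ≡ suc (suc j)) length≡ (extend-path c p bal rainbow x∉p y∉p z∉p)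
  where
    length≡ : 3 * suc j + 3 ≡ 3 * suc (suc j)
    length≡ = ≡.trans (+-comm (3 * suc j) 3) (≡.sym (*-suc 3 (suc j)))
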